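{- For each integer $n\geq 1$, there exists a 2-connected pseudo-outerplanar graph $G$ of order $2n+5$ with $\Delta(G)=3$ and $\chi'(G)=\Delta(G)+1=4$.
   Context: All graphs are finite, simple and undirected. A block is a maximal 2-connected subgraph. A graph is pseudo-outerplanar if each of its blocks can be drawn in the plane so that its vertices lie on a fixed circle, its edges lie inside the disk bounded by that circle, and each edge crosses at most one other edge. $\Delta(G)$ is the maximum degree of $G$, and $\chi'(G)$ is its edge chromatic number. -}

module Defs where

open import Data.Nat using (ℕ; _<_; _≤_)
open import Data.Fin using (Fin)
open import Data.Fin.Subset using (Subset; _∈_; _⊆_; ∣_∣; ⊤)
open import Data.Bool using (Bool; true; false)
open import Data.Vec using (tabulate)
open import Data.Product using (_×_; Σ; ∃)
open import Data.Sum using (_⊎_)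
open import Relation.Binary.PropositionalEquality using (_≡_; _≢_)
open import Relation.Nullary using (¬_)
open import Function.Definitions using (Injective)

record Graph (n : ℕ) : Set where
  field
    adj    : Fin n → Fin n → Bool
    sym    : ∀ u v → adj u v ≡ adj v u
    irrefl : ∀ v → adj v v ≡ false

open Graph public

module _ {n : ℕ} (G : Graph n) where

  Adj : Fin n → Fin n → Set
  Adj u v = adj G u v ≡ true

  neighbourhood : Fin n → Subset n
  neighbourhood v = tabulate (adj G v)

  degree : Fin n → ℕ
  degree v = ∣ neighbourhood v ∣

  MaxDegree : ℕ → Set
  MaxDegree d = (∀ v → degree v ≤ d) × ∃ λ v → degree v ≡ d

  record EdgeColouring (k : ℕ) : Set where
    field
      colour     : Fin n → Fin n → Fin k
      colour-sym : ∀ u v → Adj u v → colour u v ≡ colour v u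
      proper     : ∀ u v w → Adj u v → Adj u w → v ≢ w → colour u v ≢ colour u w

  EdgeColourable : ℕ → Set
  EdgeColourable k = EdgeColouring k

  EdgeChromaticNumber : ℕ → Set
  EdgeChromaticNumber k = EdgeColourable k × (∀ m → EdgeColourable m → k ≤ m)

  data Reach (P : Fin n → Set) : Fin n → Fin n → Set where
    here : ∀ {u} → Reach P u u
    step : ∀ {u v w} → Adj u v → P v → Reach P v w → Reach P u w

  ConnectedOn : (Fin n → Set) → Set
  ConnectedOn P = ∀ u v → P u → P v → Reach P u v

  TwoConnectedOn : Subset n → Set
  TwoConnectedOn S =
    (3 ≤ ∣ S ∣) × ConnectedOn (λ x → x ∈ S)
      × (∀ w → w ∈ S → ConnectedOn (λ x → x ∈ S × x ≢ w))

  TwoConnected : Set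
  TwoConnected = TwoConnectedOn ⊤

  -- A block: a maximal 2-connected subgraph (necessarily induced,
  -- so it is given by its vertex set).
  Block : Subset n → Set
  Block S = TwoConnectedOn S × (∀ T → S ⊆ T → TwoConnectedOn T → T ⊆ S)

  -- Drawings with vertices on a circle and edges inside the disc.
  -- The drawing is determined (up to crossings forced by topology) by the
  -- cyclic order of the vertices, given by injective positions pos.
  -- Two edges ab, cd with four distinct endpoints cross iff their
  -- endpoints interleave along the circle.
  module _ (pos : Fin n → ℕ) where

    Btw : Fin n → Fin n → Fin n → Set
    Btw a x b = (pos a < pos x × pos x < pos b) ⊎ (pos b < pos x × pos x < pos a)

    Cross : Fin n → Fin n → Fin n → Fin n → Set
    Cross a b c d =
      (c ≢ a × c ≢ b × d ≢ a × d ≢ b)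
      × ((Btw a c b × ¬ Btw a d b) ⊎ (¬ Btw a c b × Btw a d b))

  SameEdge : Fin n → Fin n → Fin n → Fin n → Set
  SameEdge c d e f = (c ≡ e × d ≡ f) ⊎ (c ≡ f × d ≡ e)

  OuterOneDrawable : Subset n → Set
  OuterOneDrawable S =
    Σ (Fin n → ℕ) λ pos → Injective _≡_ _≡_ pos ×
      (∀ a b c d e f → a ∈ S → b ∈ S → c ∈ S → d ∈ S → e ∈ S → f ∈ S →
        Adj a b → Adj c d → Adj e f →
        Cross pos a b c d → Cross pos a b e f → SameEdge c d e f)

  PseudoOuterplanar : Set
  PseudoOuterplanar = ∀ S → Block S → OuterOneDrawable S

module Submission where

-- The graph is the cycle 0, 1, …, M on M + 1 = 2n + 5 vertices, together with the rungs
-- {i, M − 1 − i} for i < n and the two diagonals {n, n + 2}, {n + 1, n + 3} of the quadrilateral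
-- n, n + 1, n + 2, n + 3. Drawn with the vertices in this order on the circle, the rungs are nested
-- and all enclose the quadrilateral, so the two diagonals form the only crossing pair; the cycle makes
-- the graph 2-connected. Every vertex except M has degree 3. In a 3-edge-colouring the colour of the
-- edge {M, 0} therefore appears at every vertex, so its colour class is a perfect matching, which an
-- odd number of vertices cannot have. Colouring the path 0, 1, …, M alternately, the chords with a
-- third colour and the edge {0, M} with a fourth gives a 4-edge-colouring.

open import Defs hiding (sym; irrefl)
open import Data.Bool using (Bool; true; false)
open import Data.Empty using (⊥; ⊥-elim)
open import Data.Fin as Fin using (Fin; zero; suc; toℕ; inject≤)
open import Data.Fin.Properties using (toℕ-fromℕ<; toℕ-injective; toℕ<n; inject≤-injective; pigeonhole)
open import Data.Fin.Subset using (Subset; ∣_∣; _∪_; _-_; ⁅_⁆; ⊤; _⊆_; Empty)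
  renaming (_∈_ to _∈ₛ_; _∉_ to _∉ₛ_)
open import Data.Fin.Subset.Properties
  using (nonempty?; Empty-unique; ∣⊥∣≡0; ∣⁅x⁆∣≡1; x∈⁅x⁆; ∣⊤∣≡n; ∈⊤; p⊆q⇒∣p∣≤∣q∣; p─⊥≡p; p─q⊆p;
         x∈p∧x≢y⇒x∈p-y; x∈p⇒∣p-x∣<∣p∣; x∈p∪q⁺)
open import Data.Nat using (ℕ; zero; suc; _≤_; _<_; _+_; _*_; z≤n; s≤s; z<s; _<?_; _≤?_; _≟_; _⊓_; _⊔_)
open import Data.Nat.DivMod using (_mod_; m<n⇒m%n≡m)
open import Data.Nat.Properties
open import Data.Nat.Tactic.RingSolver using (solve-∀)
open import Data.Product using (_×_; Σ; _,_; ∃; proj₁; proj₂; uncurry)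
open import Data.Sum using (_⊎_; inj₁; inj₂)
open import Data.Vec using ([]; _∷_; here; there; lookup; tabulate)
open import Data.Vec.Properties using (lookup∘tabulate; []=⇒lookup; lookup⇒[]=)
open import Function using (_∘_; _∘′_; mk⇔)
open import Relation.Binary.PropositionalEquality
open import Relation.Nullary using (¬_; Dec; yes; no; does; contradiction)
open import Relation.Nullary.Decidable using (_×-dec_; _⊎-dec_; dec-true; dec-false; does-⇔)
open import Relation.Unary using (Decidable)

∣p∪q∣≤∣p∣+∣q∣ : ∀ {m} (p q : Subset m) → ∣ p ∪ q ∣ ≤ ∣ p ∣ + ∣ q ∣
∣p∪q∣≤∣p∣+∣q∣ [] [] = z≤n
∣p∪q∣≤∣p∣+∣q∣ (true ∷ p) (true ∷ q) = s≤s (≤-trans (∣p∪q∣≤∣p∣+∣q∣ p q) (+-monoʳ-≤ ∣ p ∣ (n≤1+n _)))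
∣p∪q∣≤∣p∣+∣q∣ (true ∷ p) (false ∷ q) = s≤s (∣p∪q∣≤∣p∣+∣q∣ p q)
∣p∪q∣≤∣p∣+∣q∣ (false ∷ p) (true ∷ q) =
  subst (suc ∣ p ∪ q ∣ ≤_) (sym (+-suc ∣ p ∣ ∣ q ∣)) (s≤s (∣p∪q∣≤∣p∣+∣q∣ p q))
∣p∪q∣≤∣p∣+∣q∣ (false ∷ p) (false ∷ q) = ∣p∪q∣≤∣p∣+∣q∣ p q

Empty⇒∣p∣≡0 : ∀ {m} {p : Subset m} → Empty p → ∣ p ∣ ≡ 0
Empty⇒∣p∣≡0 {m} p-empty = trans (cong ∣_∣ (Empty-unique p-empty)) (∣⊥∣≡0 m)

At-most-one : ∀ {N} → (Fin N → Set) → Set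
At-most-one P = ∀ {x y} → P x → P y → x ≡ y

∣p∣≤1 : ∀ {m} (p : Subset m) → At-most-one (_∈ₛ p) → ∣ p ∣ ≤ 1
∣p∣≤1 p unique with nonempty? p
... | yes (x , x∈p) = subst (∣ p ∣ ≤_) (∣⁅x⁆∣≡1 x)
      (p⊆q⇒∣p∣≤∣q∣ λ y∈p → subst (_∈ₛ ⁅ x ⁆) (unique x∈p y∈p) (x∈⁅x⁆ x))
... | no p-empty = subst (_≤ 1) (sym (Empty⇒∣p∣≡0 p-empty)) z≤n

x∉p-x : ∀ {m} (p : Subset m) (x : Fin m) → x ∉ₛ p - x
x∉p-x (true ∷ p) zero ()
x∉p-x (false ∷ p) zero ()
x∉p-x (b ∷ p) (suc x) (there x∈p-x) = x∉p-x p x x∈p-x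

x∈p-y⇒x≢y : ∀ {m} {p : Subset m} {x y} → x ∈ₛ p - y → x ≢ y
x∈p-y⇒x≢y {p = p} {x} x∈p-x refl = x∉p-x p x x∈p-x

∣p∣≡1+∣p-x∣ : ∀ {m} {p : Subset m} {x} → x ∈ₛ p → ∣ p ∣ ≡ suc ∣ p - x ∣
∣p∣≡1+∣p-x∣ {p = true ∷ p} here = cong (suc ∘′ ∣_∣) (sym (p─⊥≡p p))
∣p∣≡1+∣p-x∣ {p = true ∷ p} (there x∈p) = cong suc (∣p∣≡1+∣p-x∣ x∈p)
∣p∣≡1+∣p-x∣ {p = false ∷ p} (there x∈p) = ∣p∣≡1+∣p-x∣ x∈p

module _ {N} (f : Fin N → Fin N) (f-involutive : ∀ x → f (f x) ≡ x) (f-fixedPointFree : ∀ x → f x ≢ x) where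

  private
    Closed : Subset N → Set
    Closed p = ∀ {x} → x ∈ₛ p → f x ∈ₛ p

    ∣p∣≡2+∣p-orbit∣ : ∀ {p x} → Closed p → x ∈ₛ p → ∣ p ∣ ≡ 2 + ∣ p - x - f x ∣
    ∣p∣≡2+∣p-orbit∣ closed x∈p = trans (∣p∣≡1+∣p-x∣ x∈p)
      (cong suc (∣p∣≡1+∣p-x∣ (x∈p∧x≢y⇒x∈p-y (closed x∈p) (f-fixedPointFree _))))

    Closed-minus-orbit : ∀ {p} x → Closed p → Closed (p - x - f x)
    Closed-minus-orbit {p} x closed {y} y∈q =
      x∈p∧x≢y⇒x∈p-y (x∈p∧x≢y⇒x∈p-y (closed y∈p) fy≢x) fy≢fx
      where
        y∈p-x = p─q⊆p _ _ y∈q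
        y∈p = p─q⊆p _ _ y∈p-x
        fy≢x : f y ≢ x
        fy≢x e = x∈p-y⇒x≢y y∈q (trans (sym (f-involutive y)) (cong f e))
        fy≢fx : f y ≢ f x
        fy≢fx e = x∈p-y⇒x≢y y∈p-x (trans (sym (f-involutive y)) (trans (cong f e) (f-involutive x)))

    Closed⇒even : ∀ m {p} → ∣ p ∣ ≡ m → Closed p → ∃ λ k → m ≡ 2 * k
    Closed⇒even zero _ _ = 0 , refl
    Closed⇒even (suc m) {p} ∣p∣≡1+m closed with nonempty? p
    ... | no p-empty = contradiction (trans (sym ∣p∣≡1+m) (Empty⇒∣p∣≡0 p-empty)) λ ()
    ... | yes (x , x∈p) with m | trans (sym ∣p∣≡1+m) (∣p∣≡2+∣p-orbit∣ closed x∈p)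
    ...   | zero   | ()
    ...   | suc m′ | 2+m′≡2+∣q∣
      with Closed⇒even m′ (sym (suc-injective (suc-injective 2+m′≡2+∣q∣))) (Closed-minus-orbit x closed)
    ...     | k , m′≡2k = suc k , trans (cong (2 +_) m′≡2k) (sym (*-suc 2 k))

  fixedPointFree-involution⇒even : ∃ λ k → N ≡ 2 * k
  fixedPointFree-involution⇒even = Closed⇒even N (∣⊤∣≡n N) (λ _ → ∈⊤)

no-four-distinct-in-Fin3 : {x y z w : Fin 3} → x ≢ y → x ≢ z → y ≢ z → w ≢ x → w ≢ y → w ≢ z → ⊥
no-four-distinct-in-Fin3 {x} {y} {z} {w} x≢y x≢z y≢z w≢x w≢y w≢z
  with pigeonhole (s≤s (s≤s (s≤s (s≤s z≤n)))) (lookup (x ∷ y ∷ z ∷ w ∷ []))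
... | zero , suc zero , _ , e = x≢y e
... | zero , suc (suc zero) , _ , e = x≢z e
... | zero , suc (suc (suc zero)) , _ , e = w≢x (sym e)
... | suc zero , suc (suc zero) , _ , e = y≢z e
... | suc zero , suc (suc (suc zero)) , _ , e = w≢y (sym e)
... | suc (suc zero) , suc (suc (suc zero)) , _ , e = w≢z (sym e)
... | i , zero , () , _
... | suc zero , suc zero , s≤s () , _
... | suc (suc zero) , suc zero , s≤s () , _
... | suc (suc zero) , suc (suc zero) , s≤s (s≤s ()) , _
... | suc (suc (suc zero)) , suc (suc (suc zero)) , s≤s (s≤s (s≤s ())) , _
... | suc (suc (suc zero)) , suc (suc zero) , s≤s (s≤s ()) , _
... | suc (suc (suc zero)) , suc zero , s≤s () , _

three-distinct-cover : {x y z : Fin 3} → x ≢ y → x ≢ z → y ≢ z → ∀ γ → γ ≡ x ⊎ γ ≡ y ⊎ γ ≡ z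
three-distinct-cover {x} {y} {z} x≢y x≢z y≢z γ with γ Fin.≟ x | γ Fin.≟ y | γ Fin.≟ z
... | yes γ≡x | _ | _ = inj₁ γ≡x
... | no _ | yes γ≡y | _ = inj₂ (inj₁ γ≡y)
... | no _ | no _ | yes γ≡z = inj₂ (inj₂ γ≡z)
... | no γ≢x | no γ≢y | no γ≢z = ⊥-elim (no-four-distinct-in-Fin3 x≢y x≢z y≢z γ≢x γ≢y γ≢z)

does-true⇒ : ∀ {A : Set} (a? : Dec A) → does a? ≡ true → A
does-true⇒ (yes a) _ = a
does-true⇒ (no _) ()

∈tabulate⁻ : ∀ {N} {f : Fin N → Bool} {x} → x ∈ₛ tabulate f → f x ≡ true
∈tabulate⁻ {f = f} {x} x∈ = trans (sym (lookup∘tabulate f x)) ([]=⇒lookup x∈)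

∈tabulate⁺ : ∀ {N} {f : Fin N → Bool} {x} → f x ≡ true → x ∈ₛ tabulate f
∈tabulate⁺ {f = f} {x} fx = lookup⇒[]= x _ (trans (lookup∘tabulate f x) fx)

∣tabulate∣≤1 : ∀ {N} {P : Fin N → Set} (P? : Decidable P) → At-most-one P → ∣ tabulate (does ∘ P?) ∣ ≤ 1
∣tabulate∣≤1 P? unique = ∣p∣≤1 _ λ x∈ y∈ →
  unique (does-true⇒ (P? _) (∈tabulate⁻ x∈)) (does-true⇒ (P? _) (∈tabulate⁻ y∈))

module _ {N} (G : Graph N) where

  three-kinds⇒degree≤3 : ∀ v {P Q R : Fin N → Set} → Decidable P → Decidable Q → Decidable R →
    At-most-one P → At-most-one Q → At-most-one R →
    (∀ {w} → Adj G v w → P w ⊎ Q w ⊎ R w) → degree G v ≤ 3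
  three-kinds⇒degree≤3 v P? Q? R? P-unique Q-unique R-unique classify = begin
    degree G v                    ≤⟨ p⊆q⇒∣p∣≤∣q∣ neighbourhood⊆ ⟩
    ∣ S P? ∪ (S Q? ∪ S R?) ∣      ≤⟨ ∣p∪q∣≤∣p∣+∣q∣ (S P?) _ ⟩
    ∣ S P? ∣ + ∣ S Q? ∪ S R? ∣    ≤⟨ +-monoʳ-≤ ∣ S P? ∣ (∣p∪q∣≤∣p∣+∣q∣ (S Q?) (S R?)) ⟩
    ∣ S P? ∣ + (∣ S Q? ∣ + ∣ S R? ∣)
      ≤⟨ +-mono-≤ (∣tabulate∣≤1 P? P-unique)
                  (+-mono-≤ (∣tabulate∣≤1 Q? Q-unique) (∣tabulate∣≤1 R? R-unique)) ⟩
    3                             ∎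
    where
      open ≤-Reasoning
      S : {A : Fin N → Set} → Decidable A → Subset N
      S A? = tabulate (does ∘ A?)
      neighbourhood⊆ : neighbourhood G v ⊆ S P? ∪ (S Q? ∪ S R?)
      neighbourhood⊆ {w} w∈ with classify (∈tabulate⁻ w∈)
      ... | inj₁ Pw = x∈p∪q⁺ (inj₁ (∈tabulate⁺ (dec-true (P? w) Pw)))
      ... | inj₂ (inj₁ Qw) = x∈p∪q⁺ (inj₂ (x∈p∪q⁺ (inj₁ (∈tabulate⁺ (dec-true (Q? w) Qw)))))
      ... | inj₂ (inj₂ Rw) = x∈p∪q⁺ (inj₂ (x∈p∪q⁺ (inj₂ (∈tabulate⁺ (dec-true (R? w) Rw)))))


  Adj⇒∈neighbourhood : ∀ {v w} → Adj G v w → w ∈ₛ neighbourhood G v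
  Adj⇒∈neighbourhood {v} = ∈tabulate⁺ {f = adj G v}

  Adj-sym : ∀ {u v} → Adj G u v → Adj G v u
  Adj-sym {u} {v} uv = trans (Graph.sym G v u) uv

  Adj⇒≢ : ∀ {u v} → Adj G u v → u ≢ v
  Adj⇒≢ {u} uu refl with trans (sym uu) (Graph.irrefl G u)
  ... | ()

  record ThreeNeighbours (v : Fin N) : Set where
    field
      a b c      : Fin N
      va         : Adj G v a
      vb         : Adj G v b
      vc         : Adj G v c
      a≢b        : a ≢ b
      a≢c        : a ≢ c
      b≢c        : b ≢ c

  ThreeNeighbours⇒3≤degree : ∀ {v} → ThreeNeighbours v → 3 ≤ degree G v
  ThreeNeighbours⇒3≤degree {v} t = begin
    3                 ≤⟨ s≤s (s≤s (≤-trans (s≤s z≤n) (x∈p⇒∣p-x∣<∣p∣ c∈p-a-b))) ⟩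
    2 + ∣ p - a - b ∣ ≤⟨ s≤s (x∈p⇒∣p-x∣<∣p∣ b∈p-a) ⟩
    1 + ∣ p - a ∣     ≤⟨ x∈p⇒∣p-x∣<∣p∣ (Adj⇒∈neighbourhood va) ⟩
    ∣ p ∣             ∎
    where
      open ≤-Reasoning
      open ThreeNeighbours t
      p = neighbourhood G v
      b∈p-a = x∈p∧x≢y⇒x∈p-y (Adj⇒∈neighbourhood vb) (≢-sym a≢b)
      c∈p-a-b = x∈p∧x≢y⇒x∈p-y (x∈p∧x≢y⇒x∈p-y (Adj⇒∈neighbourhood vc) (≢-sym a≢c)) (≢-sym b≢c)

  EdgeColouring-weaken : ∀ {m k} → m ≤ k → EdgeColouring G m → EdgeColouring G k
  EdgeColouring-weaken m≤k col = record
    { colour     = λ u v → inject≤ (colour u v) m≤k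
    ; colour-sym = λ u v uv → cong (λ γ → inject≤ γ m≤k) (colour-sym u v uv)
    ; proper     = λ u v w uv uw v≢w e → proper u v w uv uw v≢w (inject≤-injective m≤k m≤k _ _ e)
    }
    where open EdgeColouring col

  module _ {k} (col : EdgeColouring G k) where
    open EdgeColouring col

    Sees : Fin N → Fin k → Set
    Sees v γ = ∃ λ w → Adj G v w × colour v w ≡ γ

    -- the γ-coloured edges form a perfect matching, so they pair up the vertices
    colour-at-every-vertex⇒even : ∀ γ → (∀ v → Sees v γ) → ∃ λ m → N ≡ 2 * m
    colour-at-every-vertex⇒even γ sees = fixedPointFree-involution⇒even mate mate-involutive mate-fixedPointFree
      where
        mate : Fin N → Fin N
        mate v = proj₁ (sees v)
        mate-adj : ∀ v → Adj G v (mate v)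
        mate-adj v = proj₁ (proj₂ (sees v))
        mate-colour : ∀ v → colour v (mate v) ≡ γ
        mate-colour v = proj₂ (proj₂ (sees v))
        mate-involutive : ∀ v → mate (mate v) ≡ v
        mate-involutive v with mate (mate v) Fin.≟ v
        ... | yes e = e
        ... | no ne = contradiction
                (trans (mate-colour (mate v)) (trans (sym (mate-colour v)) (colour-sym v (mate v) (mate-adj v))))
                (proper (mate v) (mate (mate v)) v (mate-adj (mate v)) (Adj-sym (mate-adj v)) ne)
        mate-fixedPointFree : ∀ v → mate v ≢ v
        mate-fixedPointFree v e = Adj⇒≢ (mate-adj v) (sym e)

  ThreeNeighbours⇒sees-every-colour : (col : EdgeColouring G 3) → ∀ {v} → ThreeNeighbours v → ∀ γ → Sees col v γ
  ThreeNeighbours⇒sees-every-colour col {v} t γ =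
    pick (three-distinct-cover (proper v a b va vb a≢b) (proper v a c va vc a≢c) (proper v b c vb vc b≢c) γ)
    where
      open EdgeColouring col
      open ThreeNeighbours t
      pick : γ ≡ colour v a ⊎ γ ≡ colour v b ⊎ γ ≡ colour v c → Sees col v γ
      pick (inj₁ γ≡) = a , va , sym γ≡
      pick (inj₂ (inj₁ γ≡)) = b , vb , sym γ≡
      pick (inj₂ (inj₂ γ≡)) = c , vc , sym γ≡

-- Indices are reduced modulo M + 1, so vertex k is the vertex with index k only for k ≤ M.
vertex : ∀ {M} → ℕ → Fin (suc M)
vertex {M} k = k mod suc M

toℕ-vertex : ∀ {M k} → k ≤ M → toℕ (vertex {M} k) ≡ k
toℕ-vertex {M} {k} k≤M = trans (toℕ-fromℕ< _) (m<n⇒m%n≡m (s≤s k≤M))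

vertex-toℕ : ∀ {M} (u : Fin (suc M)) → vertex (toℕ u) ≡ u
vertex-toℕ u = toℕ-injective (toℕ-vertex (≤-pred (toℕ<n u)))

module _ {M} (G : Graph (suc M)) (P : Fin (suc M) → Set) where

  _++_ : ∀ {u v w} → Reach G P u v → Reach G P v w → Reach G P u w
  here ++ q = q
  step uv Pv p ++ q = step uv Pv (p ++ q)

  reverse : ∀ {u v} → P u → Reach G P u v → Reach G P v u
  reverse Pu here = here
  reverse Pu (step uv Pv p) = reverse Pv p ++ step (Adj-sym G uv) Pu here

  module _ (path : ∀ i → i < M → Adj G (vertex i) (vertex (suc i))) where

    walk-up : ∀ {i} j → i ≤ j → j ≤ M → (∀ k → i < k → k ≤ j → P (vertex k)) →
              Reach G P (vertex i) (vertex j)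
    walk-up zero z≤n _ _ = here
    walk-up (suc j) i≤1+j 1+j≤M P-between with m≤n⇒m<n∨m≡n i≤1+j
    ... | inj₂ refl = here
    ... | inj₁ i<1+j =
      walk-up j (≤-pred i<1+j) (<⇒≤ 1+j≤M) (λ k i<k k≤j → P-between k i<k (m≤n⇒m≤1+n k≤j))
      ++ step (path j 1+j≤M) (P-between (suc j) i<1+j ≤-refl) here

    connected-avoiding : (closing : Adj G (vertex 0) (vertex M)) → ∀ x →
      (∀ k → k ≤ M → k ≢ x → P (vertex k)) →
      ∀ {a b} → a ≤ b → b ≤ M → a ≢ x → b ≢ x → Reach G P (vertex a) (vertex b)
    connected-avoiding closing x P-rest {a} {b} a≤b b≤M a≢x b≢x with a <? x | x <? b
    ... | yes a<x | yes x<b =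
      reverse (P-rest 0 z≤n (<⇒≢ (≤-<-trans z≤n a<x))) (walk-up {0} a z≤n (≤-trans a≤b b≤M)
                (λ k _ k≤a → P-rest k (≤-trans k≤a (≤-trans a≤b b≤M)) (<⇒≢ (≤-<-trans k≤a a<x))))
      ++ step closing (P-rest M ≤-refl (≢-sym (<⇒≢ (<-≤-trans x<b b≤M))))
           (reverse (P-rest b b≤M b≢x) (walk-up M b≤M ≤-refl
              (λ k b<k k≤M → P-rest k k≤M (≢-sym (<⇒≢ (<-trans x<b b<k))))))
    ... | no a≮x | _ = walk-up b a≤b b≤M
      (λ k a<k k≤b → P-rest k (≤-trans k≤b b≤M) (≢-sym (<⇒≢ (≤-<-trans (≮⇒≥ a≮x) a<k))))
    ... | _ | no x≮b = walk-up b a≤b b≤M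
      (λ k _ k≤b → P-rest k (≤-trans k≤b b≤M) (<⇒≢ (≤-<-trans k≤b (≤∧≢⇒< (≮⇒≥ x≮b) b≢x))))

    reach-avoiding : (closing : Adj G (vertex 0) (vertex M)) → ∀ x →
      (∀ k → k ≤ M → k ≢ x → P (vertex k)) →
      ∀ u v → toℕ u ≢ x → toℕ v ≢ x → Reach G P u v
    reach-avoiding closing x P-rest u v u≢x v≢x = subst₂ (Reach G P) (vertex-toℕ u) (vertex-toℕ v)
      (connect (≤-pred (toℕ<n u)) (≤-pred (toℕ<n v)) u≢x v≢x)
      where
        connect : ∀ {a b} → a ≤ M → b ≤ M → a ≢ x → b ≢ x → Reach G P (vertex a) (vertex b)
        connect {a} {b} a≤M b≤M a≢x b≢x with ≤-total a b
        ... | inj₁ a≤b = connected-avoiding closing x P-rest a≤b b≤M a≢x b≢x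
        ... | inj₂ b≤a = reverse (P-rest b b≤M b≢x) (connected-avoiding closing x P-rest b≤a a≤M b≢x a≢x)

hamiltonian⇒TwoConnected : ∀ {M} (G : Graph (suc M)) → 2 ≤ M →
  (∀ i → i < M → Adj G (vertex i) (vertex (suc i))) → Adj G (vertex 0) (vertex M) → TwoConnected G
hamiltonian⇒TwoConnected {M} G 2≤M path closing = 3≤∣⊤∣ , connected , connected-without
  where
    3≤∣⊤∣ : 3 ≤ ∣ ⊤ {suc M} ∣
    3≤∣⊤∣ = subst (3 ≤_) (sym (∣⊤∣≡n _)) (s≤s 2≤M)
    -- avoiding the index suc M, which no vertex has, gives plain connectedness
    connected : ConnectedOn G (_∈ₛ ⊤)
    connected u v _ _ = reach-avoiding G _ path closing (suc M) (λ _ _ _ → ∈⊤) u v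
      (<⇒≢ (toℕ<n u)) (<⇒≢ (toℕ<n v))
    connected-without : ∀ w → w ∈ₛ ⊤ → ConnectedOn G (λ x → x ∈ₛ ⊤ × x ≢ w)
    connected-without w _ u v (_ , u≢w) (_ , v≢w) = reach-avoiding G _ path closing (toℕ w)
      (λ k k≤M k≢w → ∈⊤ , λ e → k≢w (trans (sym (toℕ-vertex k≤M)) (cong toℕ e)))
      u v (u≢w ∘ toℕ-injective) (v≢w ∘ toℕ-injective)

m+[3+m]≡3+[m+m] : ∀ m → m + (3 + m) ≡ 3 + (m + m)
m+[3+m]≡3+[m+m] = solve-∀

rung-below : ∀ i d → i + (4 + (suc i + d) + d) ≡ 3 + ((suc i + d) + (suc i + d))
rung-below = solve-∀

rung-above : ∀ k d → d + ((suc k + d) + (4 + k)) ≡ 3 + ((suc k + d) + (suc k + d))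
rung-above = solve-∀

2*m+5≡5+[m+m] : ∀ m → 2 * m + 5 ≡ 5 + (m + m)
2*m+5≡5+[m+m] = solve-∀

5+[n+n]≡1+2[2+n] : ∀ n → 5 + (n + n) ≡ suc (2 * (2 + n))
5+[n+n]≡1+2[2+n] = solve-∀

n+[4+k]≡4+[n+k] : ∀ n k → n + (4 + k) ≡ 4 + (n + k)
n+[4+k]≡4+[n+k] = solve-∀

module Construction (n : ℕ) where

  M : ℕ
  M = 4 + (n + n)

  -- Arc i j lists the edge {i, j} with i < j; the rungs are {i, M − 1 − i} for i < n.
  Step Closing Rung Diagonal Arc Edge Chord : ℕ → ℕ → Set
  Step i j = j ≡ suc i × j ≤ M
  Closing i j = i ≡ 0 × j ≡ M
  Rung i j = i < n × i + j ≡ 3 + (n + n)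
  Diagonal i j = (i ≡ n × j ≡ 2 + n) ⊎ (i ≡ 1 + n × j ≡ 3 + n)
  Arc i j = Step i j ⊎ Closing i j ⊎ Rung i j ⊎ Diagonal i j
  Edge i j = Arc i j ⊎ Arc j i
  Chord i j = Rung i j ⊎ Rung j i ⊎ Diagonal i j ⊎ Diagonal j i

  step? closing? rung? diagonal? arc? chord? : ∀ i j → Dec _
  step? i j = (j ≟ suc i) ×-dec (j ≤? M)
  closing? i j = (i ≟ 0) ×-dec (j ≟ M)
  rung? i j = (i <? n) ×-dec (i + j ≟ 3 + (n + n))
  diagonal? i j = ((i ≟ n) ×-dec (j ≟ 2 + n)) ⊎-dec ((i ≟ 1 + n) ×-dec (j ≟ 3 + n))
  arc? i j = step? i j ⊎-dec closing? i j ⊎-dec rung? i j ⊎-dec diagonal? i j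
  chord? i j = rung? i j ⊎-dec rung? j i ⊎-dec diagonal? i j ⊎-dec diagonal? j i

  edge? : ∀ i j → Dec (Edge i j)
  edge? i j = arc? i j ⊎-dec arc? j i

  Edge-sym : ∀ {i j} → Edge i j → Edge j i
  Edge-sym (inj₁ ij) = inj₂ ij
  Edge-sym (inj₂ ji) = inj₁ ji

  k+n≤M : ∀ {k} → k ≤ 4 → k + n ≤ M
  k+n≤M k≤4 = +-mono-≤ k≤4 (m≤m+n n n)

  k+n≤3+2n : ∀ {k} → k ≤ 3 → k + n ≤ 3 + (n + n)
  k+n≤3+2n k≤3 = +-mono-≤ k≤3 (m≤m+n n n)

  Rung⇒4+n≤ : ∀ {i j} → Rung i j → 4 + n ≤ j
  Rung⇒4+n≤ {i} {j} (i<n , i+j≡3+2n) = ≮⇒≥ λ j<4+n → <-irrefl i+j≡3+2n (begin-strict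
    i + j         <⟨ +-mono-<-≤ i<n (≤-pred j<4+n) ⟩
    n + (3 + n)   ≡⟨ m+[3+m]≡3+[m+m] n ⟩
    3 + (n + n)   ∎)
    where open ≤-Reasoning

  Rung⇒≤3+2n : ∀ {i j} → Rung i j → j ≤ 3 + (n + n)
  Rung⇒≤3+2n {i} {j} (_ , i+j≡3+2n) = subst (j ≤_) i+j≡3+2n (m≤n+m j i)

  Diagonal-source : ∀ {i j} → Diagonal i j → n ≤ i × i ≤ 1 + n
  Diagonal-source (inj₁ (refl , _)) = ≤-refl , n≤1+n n
  Diagonal-source (inj₂ (refl , _)) = n≤1+n n , ≤-refl

  Diagonal-target : ∀ {i j} → Diagonal i j → 2 + n ≤ j × j ≤ 3 + n
  Diagonal-target (inj₁ (_ , refl)) = ≤-refl , n≤1+n _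
  Diagonal-target (inj₂ (_ , refl)) = n≤1+n _ , ≤-refl

  Arc⇒< : ∀ {i j} → Arc i j → i < j × j ≤ M
  Arc⇒< (inj₁ (refl , j≤M)) = ≤-refl , j≤M
  Arc⇒< (inj₂ (inj₁ (refl , refl))) = z<s , ≤-refl
  Arc⇒< (inj₂ (inj₂ (inj₁ r))) =
    <-≤-trans (proj₁ r) (≤-trans (m≤n+m n 4) (Rung⇒4+n≤ r)) , ≤-trans (Rung⇒≤3+2n r) (n≤1+n _)
  Arc⇒< (inj₂ (inj₂ (inj₂ d))) =
    <-≤-trans (s≤s (proj₂ (Diagonal-source d))) (proj₁ (Diagonal-target d)) ,
    ≤-trans (proj₂ (Diagonal-target d)) (k+n≤M (n≤1+n 3))

  Edge⇒≤M : ∀ {i j} → Edge i j → i ≤ M × j ≤ M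
  Edge⇒≤M (inj₁ ij) = <⇒≤ (<-≤-trans (proj₁ (Arc⇒< ij)) (proj₂ (Arc⇒< ij))) , proj₂ (Arc⇒< ij)
  Edge⇒≤M (inj₂ ji) = proj₂ (Arc⇒< ji) , <⇒≤ (<-≤-trans (proj₁ (Arc⇒< ji)) (proj₂ (Arc⇒< ji)))

  Edge-irrefl : ∀ {i} → ¬ Edge i i
  Edge-irrefl (inj₁ ii) = <-irrefl refl (proj₁ (Arc⇒< ii))
  Edge-irrefl (inj₂ ii) = <-irrefl refl (proj₁ (Arc⇒< ii))

  G : Graph (suc M)
  G = record
    { adj    = λ u v → does (edge? (toℕ u) (toℕ v))
    ; sym    = λ u v → does-⇔ (mk⇔ Edge-sym Edge-sym) (edge? (toℕ u) (toℕ v)) (edge? (toℕ v) (toℕ u))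
    ; irrefl = λ v → dec-false (edge? (toℕ v) (toℕ v)) Edge-irrefl
    }

  Adj⇒Edge : ∀ {u v} → Adj G u v → Edge (toℕ u) (toℕ v)
  Adj⇒Edge {u} {v} = does-true⇒ (edge? (toℕ u) (toℕ v))

  Edge⇒Adj : ∀ {i j} → Edge i j → Adj G (vertex i) (vertex j)
  Edge⇒Adj {i} {j} ij = dec-true (edge? _ _)
    (subst₂ Edge (sym (toℕ-vertex i≤M)) (sym (toℕ-vertex j≤M)) ij)
    where i≤M = proj₁ (Edge⇒≤M ij); j≤M = proj₂ (Edge⇒≤M ij)

  vertex-injective : ∀ {i j} → i ≤ M → j ≤ M → i ≢ j → vertex {M} i ≢ vertex j
  vertex-injective i≤M j≤M i≢j e = i≢j (trans (sym (toℕ-vertex i≤M)) (trans (cong toℕ e) (toℕ-vertex j≤M)))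

  Chord-sym : ∀ {i j} → Chord i j → Chord j i
  Chord-sym (inj₁ r) = inj₂ (inj₁ r)
  Chord-sym (inj₂ (inj₁ r)) = inj₁ r
  Chord-sym (inj₂ (inj₂ (inj₁ d))) = inj₂ (inj₂ (inj₂ d))
  Chord-sym (inj₂ (inj₂ (inj₂ d))) = inj₂ (inj₂ (inj₁ d))

  Chord⇒Edge : ∀ {i j} → Chord i j → Edge i j
  Chord⇒Edge (inj₁ r) = inj₁ (inj₂ (inj₂ (inj₁ r)))
  Chord⇒Edge (inj₂ (inj₁ r)) = inj₂ (inj₂ (inj₂ (inj₁ r)))
  Chord⇒Edge (inj₂ (inj₂ (inj₁ d))) = inj₁ (inj₂ (inj₂ (inj₂ d)))
  Chord⇒Edge (inj₂ (inj₂ (inj₂ d))) = inj₂ (inj₂ (inj₂ (inj₂ d)))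

  Diagonal-at⇒ : ∀ {i j} → Diagonal i j ⊎ Diagonal j i → n ≤ i × i ≤ 3 + n
  Diagonal-at⇒ (inj₁ d) = proj₁ (Diagonal-source d) , ≤-trans (proj₂ (Diagonal-source d)) (s≤s (m≤n+m n 2))
  Diagonal-at⇒ (inj₂ d) = ≤-trans (m≤n+m n 2) (proj₁ (Diagonal-target d)) , proj₂ (Diagonal-target d)

  Diagonal-unique : ∀ {i j k} → Diagonal i j ⊎ Diagonal j i → Diagonal i k ⊎ Diagonal k i → j ≡ k
  Diagonal-unique (inj₁ (inj₁ (refl , refl))) (inj₁ (inj₁ (_ , refl))) = refl
  Diagonal-unique (inj₁ (inj₁ (refl , refl))) (inj₁ (inj₂ (e , _))) = contradiction e (<⇒≢ (n<1+n n))
  Diagonal-unique (inj₁ (inj₂ (refl , refl))) (inj₁ (inj₁ (e , _))) = contradiction (sym e) (<⇒≢ (n<1+n n))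
  Diagonal-unique (inj₁ (inj₂ (refl , refl))) (inj₁ (inj₂ (_ , refl))) = refl
  Diagonal-unique (inj₂ (inj₁ (refl , refl))) (inj₂ (inj₁ (refl , _))) = refl
  Diagonal-unique (inj₂ (inj₁ (refl , refl))) (inj₂ (inj₂ (_ , e))) = contradiction e (<⇒≢ (n<1+n _))
  Diagonal-unique (inj₂ (inj₂ (refl , refl))) (inj₂ (inj₁ (_ , e))) = contradiction (sym e) (<⇒≢ (n<1+n _))
  Diagonal-unique (inj₂ (inj₂ (refl , refl))) (inj₂ (inj₂ (refl , _))) = refl
  Diagonal-unique (inj₁ d) (inj₂ d′) = contradiction (proj₂ (Diagonal-source d)) (<⇒≱ (proj₁ (Diagonal-target d′)))
  Diagonal-unique (inj₂ d) (inj₁ d′) = contradiction (proj₂ (Diagonal-source d′)) (<⇒≱ (proj₁ (Diagonal-target d)))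

  -- a chord at i has i < n, n ≤ i ≤ 3 + n or 4 + n ≤ i according to its kind, so two chords at i have the same kind
  Chord-unique : ∀ {i j k} → Chord i j → Chord i k → j ≡ k
  Chord-unique {i} (inj₁ (_ , e)) (inj₁ (_ , e′)) = +-cancelˡ-≡ i _ _ (trans e (sym e′))
  Chord-unique {i} {j} {k} (inj₂ (inj₁ (_ , e))) (inj₂ (inj₁ (_ , e′))) = +-cancelʳ-≡ i j k (trans e (sym e′))
  Chord-unique (inj₂ (inj₂ d)) (inj₂ (inj₂ d′)) = Diagonal-unique d d′
  Chord-unique (inj₁ (i<n , _)) (inj₂ (inj₁ r)) = contradiction (≤-trans (m≤n+m n 4) (Rung⇒4+n≤ r)) (<⇒≱ i<n)
  Chord-unique (inj₂ (inj₁ r)) (inj₁ (i<n , _)) = contradiction (≤-trans (m≤n+m n 4) (Rung⇒4+n≤ r)) (<⇒≱ i<n)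
  Chord-unique (inj₁ (i<n , _)) (inj₂ (inj₂ d)) = contradiction (proj₁ (Diagonal-at⇒ d)) (<⇒≱ i<n)
  Chord-unique (inj₂ (inj₂ d)) (inj₁ (i<n , _)) = contradiction (proj₁ (Diagonal-at⇒ d)) (<⇒≱ i<n)
  Chord-unique (inj₂ (inj₁ r)) (inj₂ (inj₂ d)) = contradiction (Rung⇒4+n≤ r) (<⇒≱ (s≤s (proj₂ (Diagonal-at⇒ d))))
  Chord-unique (inj₂ (inj₂ d)) (inj₂ (inj₁ r)) = contradiction (Rung⇒4+n≤ r) (<⇒≱ (s≤s (proj₂ (Diagonal-at⇒ d))))

  Chord⇒<M : ∀ {i j} → Chord i j → j < M
  Chord⇒<M (inj₁ r) = s≤s (Rung⇒≤3+2n r)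
  Chord⇒<M (inj₂ (inj₁ (j<n , _))) = <-≤-trans j<n (≤-trans (m≤n+m n 4) (k+n≤M ≤-refl))
  Chord⇒<M (inj₂ (inj₂ (inj₁ d))) = s≤s (≤-trans (proj₂ (Diagonal-target d)) (k+n≤3+2n ≤-refl))
  Chord⇒<M (inj₂ (inj₂ (inj₂ d))) = s≤s (≤-trans (proj₂ (Diagonal-source d)) (k+n≤3+2n (s≤s z≤n)))

  Chord-not-step : ∀ {i} → ¬ Chord i (suc i)
  Chord-not-step (inj₁ r@(i<n , _)) = <⇒≱ (s≤s (≤-trans i<n (m≤n+m n 3))) (Rung⇒4+n≤ r)
  Chord-not-step (inj₂ (inj₁ r@(1+i<n , _))) =
    <⇒≱ (<-trans 1+i<n (m≤n+m (suc n) 3)) (≤-trans (Rung⇒4+n≤ r) (n≤1+n _))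
  Chord-not-step (inj₂ (inj₂ (inj₁ (inj₁ (refl , e))))) = <⇒≢ (n<1+n n) (suc-injective e)
  Chord-not-step (inj₂ (inj₂ (inj₁ (inj₂ (refl , e))))) = <⇒≢ (n<1+n _) (suc-injective e)
  Chord-not-step (inj₂ (inj₂ (inj₂ d))) =
    <⇒≱ (proj₁ (Diagonal-target d)) (≤-trans (n≤1+n _) (proj₂ (Diagonal-source d)))

  n+[4+k]<M⇒k<n : ∀ {k} → n + (4 + k) < M → k < n
  n+[4+k]<M⇒k<n {k} lt =
    +-cancelˡ-< n k n (+-cancelˡ-< 4 (n + k) (n + n) (subst (_< M) (n+[4+k]≡4+[n+k] n k) lt))

  chord-exists : ∀ i → i < M → ∃ (Chord i)
  chord-exists i i<M with i <? n
  ... | yes i<n with m≤n⇒∃[o]m+o≡n i<n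
  ...   | d , 1+i+d≡n = 4 + n + d , inj₁ (i<n ,
          subst (λ m → i + (4 + m + d) ≡ 3 + (m + m)) 1+i+d≡n (rung-below i d))
  chord-exists i i<M | no i≮n with m≤n⇒∃[o]m+o≡n (≮⇒≥ i≮n)
  ... | 0 , refl = 2 + n , inj₂ (inj₂ (inj₁ (inj₁ (+-identityʳ n , refl))))
  ... | 1 , refl = 3 + n , inj₂ (inj₂ (inj₁ (inj₂ (+-comm n 1 , refl))))
  ... | 2 , refl = n , inj₂ (inj₂ (inj₂ (inj₁ (refl , +-comm n 2))))
  ... | 3 , refl = 1 + n , inj₂ (inj₂ (inj₂ (inj₂ (refl , +-comm n 3))))
  ... | suc (suc (suc (suc k))) , refl with m≤n⇒∃[o]m+o≡n (n+[4+k]<M⇒k<n i<M)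
  ...   | d , 1+k+d≡n = d , inj₂ (inj₁ ((subst (d <_) 1+k+d≡n (m<n+m d z<s)) ,
          subst (λ m → d + (m + (4 + k)) ≡ 3 + (m + m)) 1+k+d≡n (rung-above k d)))

  twoConnected : TwoConnected G
  twoConnected = hamiltonian⇒TwoConnected G (s≤s (s≤s z≤n))
    (λ i 1+i≤M → Edge⇒Adj (inj₁ (inj₁ (refl , 1+i≤M))))
    (Edge⇒Adj (inj₁ (inj₂ (inj₁ (refl , refl)))))

  Successor Predecessor : ℕ → ℕ → Set
  Successor i j = Step i j ⊎ Closing j i
  Predecessor i j = Step j i ⊎ Closing i j

  Successor-unique : ∀ {i j k} → Successor i j → Successor i k → j ≡ k
  Successor-unique (inj₁ (refl , _)) (inj₁ (refl , _)) = refl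
  Successor-unique (inj₁ (refl , 1+M≤M)) (inj₂ (_ , refl)) = contradiction 1+M≤M (<-irrefl refl)
  Successor-unique (inj₂ (_ , refl)) (inj₁ (refl , 1+M≤M)) = contradiction 1+M≤M (<-irrefl refl)
  Successor-unique (inj₂ (refl , _)) (inj₂ (refl , _)) = refl

  Predecessor-unique : ∀ {i j k} → Predecessor i j → Predecessor i k → j ≡ k
  Predecessor-unique (inj₁ (refl , _)) (inj₁ (e , _)) = suc-injective e
  Predecessor-unique (inj₁ (refl , _)) (inj₂ (() , _))
  Predecessor-unique (inj₂ (refl , _)) (inj₁ (() , _))
  Predecessor-unique (inj₂ (_ , refl)) (inj₂ (_ , refl)) = refl

  Edge⇒kind : ∀ {i j} → Edge i j → Successor i j ⊎ Predecessor i j ⊎ Chord i j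
  Edge⇒kind (inj₁ (inj₁ s)) = inj₁ (inj₁ s)
  Edge⇒kind (inj₁ (inj₂ (inj₁ c))) = inj₂ (inj₁ (inj₂ c))
  Edge⇒kind (inj₁ (inj₂ (inj₂ (inj₁ r)))) = inj₂ (inj₂ (inj₁ r))
  Edge⇒kind (inj₁ (inj₂ (inj₂ (inj₂ d)))) = inj₂ (inj₂ (inj₂ (inj₂ (inj₁ d))))
  Edge⇒kind (inj₂ (inj₁ s)) = inj₂ (inj₁ (inj₁ s))
  Edge⇒kind (inj₂ (inj₂ (inj₁ c))) = inj₁ (inj₂ c)
  Edge⇒kind (inj₂ (inj₂ (inj₂ (inj₁ r)))) = inj₂ (inj₂ (inj₂ (inj₁ r)))
  Edge⇒kind (inj₂ (inj₂ (inj₂ (inj₂ d)))) = inj₂ (inj₂ (inj₂ (inj₂ (inj₂ d))))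

  degree≤3 : ∀ v → degree G v ≤ 3
  degree≤3 v = three-kinds⇒degree≤3 G v
    (λ w → step? i (toℕ w) ⊎-dec closing? (toℕ w) i)
    (λ w → step? (toℕ w) i ⊎-dec closing? i (toℕ w))
    (λ w → chord? i (toℕ w))
    (λ s s′ → toℕ-injective (Successor-unique s s′))
    (λ p p′ → toℕ-injective (Predecessor-unique p p′))
    (λ c c′ → toℕ-injective (Chord-unique c c′))
    (Edge⇒kind ∘ Adj⇒Edge)
    where i = toℕ v

  previous : ℕ → ℕ
  previous zero = M
  previous (suc i) = i

  Edge-previous : ∀ i → i ≤ M → Edge i (previous i)
  Edge-previous zero _ = inj₁ (inj₂ (inj₁ (refl , refl)))
  Edge-previous (suc i) 1+i≤M = inj₂ (inj₁ (refl , 1+i≤M))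

  previous≤M : ∀ i → i ≤ M → previous i ≤ M
  previous≤M zero _ = ≤-refl
  previous≤M (suc i) 1+i≤M = ≤-trans (n≤1+n i) 1+i≤M

  suc≢previous : ∀ i → suc i ≢ previous i
  suc≢previous zero ()
  suc≢previous (suc i) e = <⇒≢ (<-trans (n<1+n i) (n<1+n (suc i))) (sym e)

  previous≢chord : ∀ {i j} → Chord i j → previous i ≢ j
  previous≢chord {zero} c refl = <-irrefl refl (Chord⇒<M c)
  previous≢chord {suc i} c refl = Chord-not-step (Chord-sym c)

  threeNeighbours : ∀ i → i < M → ThreeNeighbours G (vertex i)
  threeNeighbours i i<M = with-chord (proj₂ (chord-exists i i<M))
    where
      with-chord : ∀ {j} → Chord i j → ThreeNeighbours G (vertex i)
      with-chord {j} ij = record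
        { a = vertex (suc i) ; b = vertex (previous i) ; c = vertex j
        ; va = Edge⇒Adj (inj₁ (inj₁ (refl , i<M)))
        ; vb = Edge⇒Adj (Edge-previous i (<⇒≤ i<M))
        ; vc = Edge⇒Adj (Chord⇒Edge ij)
        ; a≢b = vertex-injective i<M (previous≤M i (<⇒≤ i<M)) (suc≢previous i)
        ; a≢c = vertex-injective i<M j≤M λ { refl → Chord-not-step ij }
        ; b≢c = vertex-injective (previous≤M i (<⇒≤ i<M)) j≤M (previous≢chord ij)
        }
        where j≤M = <⇒≤ (Chord⇒<M ij)

  maxDegree : MaxDegree G 3
  maxDegree = degree≤3 , vertex 0 ,
    ≤-antisym (degree≤3 (vertex 0)) (ThreeNeighbours⇒3≤degree G (threeNeighbours 0 z<s))

  parity : ℕ → Fin 4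
  parity zero = Fin.zero
  parity (suc zero) = Fin.suc Fin.zero
  parity (suc (suc i)) = parity i

  chord-colour closing-colour : Fin 4
  chord-colour = Fin.suc (Fin.suc Fin.zero)
  closing-colour = Fin.suc (Fin.suc (Fin.suc Fin.zero))

  parity-suc : ∀ i → parity (suc i) ≢ parity i
  parity-suc zero ()
  parity-suc (suc zero) ()
  parity-suc (suc (suc i)) = parity-suc i

  parity≢chord : ∀ i → parity i ≢ chord-colour
  parity≢chord zero ()
  parity≢chord (suc zero) ()
  parity≢chord (suc (suc i)) = parity≢chord i

  parity≢closing : ∀ i → parity i ≢ closing-colour
  parity≢closing zero ()
  parity≢closing (suc zero) ()
  parity≢closing (suc (suc i)) = parity≢closing i

  arcColour : ℕ → ℕ → Fin 4
  arcColour a b with b ≟ suc a | closing? a b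
  ... | yes _ | _ = parity a
  ... | no _ | yes _ = closing-colour
  ... | no _ | no _ = chord-colour

  arcColour-step : ∀ a → arcColour a (suc a) ≡ parity a
  arcColour-step a with suc a ≟ suc a
  ... | yes _ = refl
  ... | no 1+a≢1+a = contradiction refl 1+a≢1+a

  arcColour-closing : arcColour 0 M ≡ closing-colour
  arcColour-closing with M ≟ 1 | closing? 0 M
  ... | no _ | yes _ = refl
  ... | no _ | no ¬closing = contradiction (refl , refl) ¬closing

  arcColour-chord : ∀ {a b} → Chord a b → arcColour a b ≡ chord-colour
  arcColour-chord {a} {b} ab with b ≟ suc a | closing? a b
  ... | yes refl | _ = contradiction ab Chord-not-step
  ... | no _ | yes (_ , refl) = contradiction (Chord⇒<M ab) (<-irrefl refl)
  ... | no _ | no _ = refl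

  edgeColour : ℕ → ℕ → Fin 4
  edgeColour i j = arcColour (i ⊓ j) (i ⊔ j)

  edgeColour-sym : ∀ i j → edgeColour i j ≡ edgeColour j i
  edgeColour-sym i j = cong₂ arcColour (⊓-comm i j) (⊔-comm i j)

  data Incidence : ℕ → ℕ → Set where
    up        : ∀ {i} → Incidence i (suc i)
    down      : ∀ {j} → Incidence (suc j) j
    closing   : Incidence 0 M
    closing⁻¹ : Incidence M 0
    chord     : ∀ {i j} → Chord i j → Incidence i j

  incidence : ∀ {i j} → Edge i j → Incidence i j
  incidence (inj₁ (inj₁ (refl , _))) = up
  incidence (inj₂ (inj₁ (refl , _))) = down
  incidence (inj₁ (inj₂ (inj₁ (refl , refl)))) = closing
  incidence (inj₂ (inj₂ (inj₁ (refl , refl)))) = closing⁻¹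
  incidence (inj₁ (inj₂ (inj₂ (inj₁ r)))) = chord (inj₁ r)
  incidence (inj₂ (inj₂ (inj₂ (inj₁ r)))) = chord (inj₂ (inj₁ r))
  incidence (inj₁ (inj₂ (inj₂ (inj₂ d)))) = chord (inj₂ (inj₂ (inj₁ d)))
  incidence (inj₂ (inj₂ (inj₂ (inj₂ d)))) = chord (inj₂ (inj₂ (inj₂ d)))

  incidenceColour : ∀ {i j} → Incidence i j → Fin 4
  incidenceColour (up {i}) = parity i
  incidenceColour (down {j}) = parity j
  incidenceColour closing = closing-colour
  incidenceColour closing⁻¹ = closing-colour
  incidenceColour (chord _) = chord-colour

  edgeColour-incidence : ∀ {i j} (ι : Incidence i j) → edgeColour i j ≡ incidenceColour ι
  edgeColour-incidence (up {i}) = begin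
    arcColour (i ⊓ suc i) (i ⊔ suc i) ≡⟨ cong₂ arcColour (m≤n⇒m⊓n≡m (n≤1+n i)) (m≤n⇒m⊔n≡n (n≤1+n i)) ⟩
    arcColour i (suc i)               ≡⟨ arcColour-step i ⟩
    parity i                          ∎
    where open ≡-Reasoning
  edgeColour-incidence (down {j}) = trans (edgeColour-sym (suc j) j) (edgeColour-incidence (up {j}))
  edgeColour-incidence closing = arcColour-closing
  edgeColour-incidence closing⁻¹ = arcColour-closing
  edgeColour-incidence (chord {i} {j} ij) with ≤-total i j
  ... | inj₁ i≤j = trans (cong₂ arcColour (m≤n⇒m⊓n≡m i≤j) (m≤n⇒m⊔n≡n i≤j)) (arcColour-chord ij)
  ... | inj₂ j≤i = trans (cong₂ arcColour (m≥n⇒m⊓n≡n j≤i) (m≥n⇒m⊔n≡m j≤i)) (arcColour-chord (Chord-sym ij))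

  incidenceColour-injective : ∀ {i j k} (ι : Incidence i j) (κ : Incidence i k) →
    incidenceColour ι ≡ incidenceColour κ → j ≡ k
  incidenceColour-injective up up _ = refl
  incidenceColour-injective (up {suc k}) down e = contradiction e (parity-suc k)
  incidenceColour-injective (up {M}) closing⁻¹ e = contradiction e (parity≢closing M)
  incidenceColour-injective (up {i}) (chord _) e = contradiction e (parity≢chord i)
  incidenceColour-injective (down {j}) up e = contradiction (sym e) (parity-suc j)
  incidenceColour-injective down down _ = refl
  incidenceColour-injective (down {j}) closing⁻¹ e = contradiction e (parity≢closing j)
  incidenceColour-injective (down {j}) (chord _) e = contradiction e (parity≢chord j)
  incidenceColour-injective closing closing _ = refl
  incidenceColour-injective closing⁻¹ (up {i}) e = contradiction (sym e) (parity≢closing M)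
  incidenceColour-injective closing⁻¹ (down {j}) e = contradiction (sym e) (parity≢closing j)
  incidenceColour-injective closing⁻¹ closing⁻¹ _ = refl
  incidenceColour-injective (chord _) (up {i}) e = contradiction (sym e) (parity≢chord i)
  incidenceColour-injective (chord _) (down {j}) e = contradiction (sym e) (parity≢chord j)
  incidenceColour-injective (chord ij) (chord ik) _ = Chord-unique ij ik

  edgeColour-proper : ∀ u v w → Adj G u v → Adj G u w → v ≢ w →
    edgeColour (toℕ u) (toℕ v) ≢ edgeColour (toℕ u) (toℕ w)
  edgeColour-proper u v w uv uw v≢w e = v≢w (toℕ-injective (incidenceColour-injective ι κ (begin
    incidenceColour ι            ≡⟨ edgeColour-incidence ι ⟨
    edgeColour (toℕ u) (toℕ v)   ≡⟨ e ⟩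
    edgeColour (toℕ u) (toℕ w)   ≡⟨ edgeColour-incidence κ ⟩
    incidenceColour κ            ∎)))
    where
      open ≡-Reasoning
      ι = incidence (Adj⇒Edge {u} {v} uv)
      κ = incidence (Adj⇒Edge {u} {w} uw)

  colouring : EdgeColouring G 4
  colouring = record
    { colour     = λ u v → edgeColour (toℕ u) (toℕ v)
    ; colour-sym = λ u v _ → edgeColour-sym (toℕ u) (toℕ v)
    ; proper     = edgeColour-proper
    }

  sees-colour-of-closing : (col : EdgeColouring G 3) →
    let open EdgeColouring col in ∀ v → Sees G col v (colour (vertex M) (vertex 0))
  sees-colour-of-closing col v with toℕ v <? M
  ... | yes v<M = subst (λ u → Sees G col u _) (vertex-toℕ v)
    (ThreeNeighbours⇒sees-every-colour G col (threeNeighbours (toℕ v) v<M) _)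
  ... | no v≮M = subst (λ u → Sees G col u _) vertex-M≡v
    (vertex 0 , Edge⇒Adj (inj₂ (inj₂ (inj₁ (refl , refl)))) , refl)
    where
      vertex-M≡v : vertex M ≡ v
      vertex-M≡v = trans (cong vertex (≤-antisym (≮⇒≥ v≮M) (≤-pred (toℕ<n v)))) (vertex-toℕ v)

  1+M-odd : ∀ m → suc M ≢ 2 * m
  1+M-odd m 1+M≡2m = even≢odd m (2 + n) (trans (sym 1+M≡2m) (5+[n+n]≡1+2[2+n] n))

  no-3-colouring : ¬ EdgeColouring G 3
  no-3-colouring col = uncurry 1+M-odd (colour-at-every-vertex⇒even G col _ (sees-colour-of-closing col))

  edgeChromaticNumber : EdgeChromaticNumber G 4
  edgeChromaticNumber = colouring , at-least-4
    where
      at-least-4 : ∀ m → EdgeColouring G m → 4 ≤ m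
      at-least-4 m col with 4 ≤? m
      ... | yes 4≤m = 4≤m
      ... | no 4≰m = contradiction (EdgeColouring-weaken G (≤-pred (≰⇒> 4≰m)) col) no-3-colouring

  Between : ℕ → ℕ → ℕ → Set
  Between a x b = (a < x × x < b) ⊎ (b < x × x < a)

  Crossing : ℕ → ℕ → ℕ → ℕ → Set
  Crossing a b c d = (c ≢ a × c ≢ b × d ≢ a × d ≢ b)
    × ((Between a c b × ¬ Between a d b) ⊎ (¬ Between a c b × Between a d b))

  Between-sym : ∀ {a x b} → Between a x b → Between b x a
  Between-sym (inj₁ p) = inj₂ p
  Between-sym (inj₂ p) = inj₁ p

  Crossing-swapˡ : ∀ {a b c d} → Crossing a b c d → Crossing b a c d
  Crossing-swapˡ ((c≢a , c≢b , d≢a , d≢b) , inj₁ (c∈ , d∉)) =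
    (c≢b , c≢a , d≢b , d≢a) , inj₁ (Between-sym c∈ , d∉ ∘ Between-sym)
  Crossing-swapˡ ((c≢a , c≢b , d≢a , d≢b) , inj₂ (c∉ , d∈)) =
    (c≢b , c≢a , d≢b , d≢a) , inj₂ (c∉ ∘ Between-sym , Between-sym d∈)

  Crossing-swapʳ : ∀ {a b c d} → Crossing a b c d → Crossing a b d c
  Crossing-swapʳ ((c≢a , c≢b , d≢a , d≢b) , inj₁ (c∈ , d∉)) = (d≢a , d≢b , c≢a , c≢b) , inj₂ (d∉ , c∈)
  Crossing-swapʳ ((c≢a , c≢b , d≢a , d≢b) , inj₂ (c∉ , d∈)) = (d≢a , d≢b , c≢a , c≢b) , inj₁ (d∈ , c∉)

  Interleaved : ℕ → ℕ → ℕ → ℕ → Set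
  Interleaved a b c d = a < c × c < b × b < d

  Between⇒< : ∀ {a x b} → a < b → Between a x b → a < x × x < b
  Between⇒< _ (inj₁ p) = p
  Between⇒< a<b (inj₂ (b<x , x<a)) = contradiction (<-trans b<x x<a) (<-asym a<b)

  Crossing⇒Interleaved : ∀ {a b c d} → a < b → c < d → Crossing a b c d →
    Interleaved a b c d ⊎ Interleaved c d a b
  Crossing⇒Interleaved a<b c<d ((_ , _ , _ , d≢b) , inj₁ (c∈ , d∉)) with Between⇒< a<b c∈
  ... | a<c , c<b = inj₁ (a<c , c<b , ≤∧≢⇒< (≮⇒≥ λ d<b → d∉ (inj₁ (<-trans a<c c<d , d<b))) (≢-sym d≢b))
  Crossing⇒Interleaved a<b c<d ((c≢a , _ , _ , _) , inj₂ (c∉ , d∈)) with Between⇒< a<b d∈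
  ... | a<d , d<b = inj₂ (≤∧≢⇒< (≮⇒≥ λ a<c → c∉ (inj₁ (a<c , <-trans c<d d<b))) c≢a , a<d , d<b)

  -- rungs are nested, and all diagonal endpoints lie strictly inside every rung
  interleaved-arcs : ∀ {a b c d} → Arc a b → Arc c d → Interleaved a b c d →
    (a ≡ n × b ≡ 2 + n) × (c ≡ 1 + n × d ≡ 3 + n)
  interleaved-arcs (inj₁ (refl , _)) _ (a<c , c<1+a , _) = contradiction (≤-pred c<1+a) (<⇒≱ a<c)
  interleaved-arcs (inj₂ (inj₁ (_ , refl))) cd (_ , _ , M<d) = contradiction (proj₂ (Arc⇒< cd)) (<⇒≱ M<d)
  interleaved-arcs (inj₂ (inj₂ _)) (inj₁ (refl , _)) (_ , c<b , b<1+c) = contradiction (≤-pred b<1+c) (<⇒≱ c<b)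
  interleaved-arcs (inj₂ (inj₂ _)) (inj₂ (inj₁ (refl , _))) (() , _)
  interleaved-arcs (inj₂ (inj₂ (inj₁ (_ , e)))) (inj₂ (inj₂ (inj₁ (_ , e′)))) (a<c , _ , b<d) =
    contradiction (trans e (sym e′)) (<⇒≢ (+-mono-< a<c b<d))
  interleaved-arcs (inj₂ (inj₂ (inj₁ r))) (inj₂ (inj₂ (inj₂ d))) (_ , _ , b<d) =
    contradiction (≤-trans (Rung⇒4+n≤ r) (<⇒≤ b<d)) (<⇒≱ (s≤s (proj₂ (Diagonal-target d))))
  interleaved-arcs (inj₂ (inj₂ (inj₂ d))) (inj₂ (inj₂ (inj₁ (c<n , _)))) (a<c , _) =
    contradiction (≤-trans (proj₁ (Diagonal-source d)) (<⇒≤ a<c)) (<⇒≱ c<n)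
  interleaved-arcs (inj₂ (inj₂ (inj₂ (inj₁ (refl , refl))))) (inj₂ (inj₂ (inj₂ (inj₁ (refl , _))))) (n<n , _) =
    contradiction n<n (<-irrefl refl)
  interleaved-arcs (inj₂ (inj₂ (inj₂ (inj₁ (refl , refl))))) (inj₂ (inj₂ (inj₂ (inj₂ (refl , refl))))) _ =
    (refl , refl) , (refl , refl)
  interleaved-arcs (inj₂ (inj₂ (inj₂ (inj₂ (refl , refl))))) (inj₂ (inj₂ (inj₂ (inj₁ (refl , _))))) (1+n<n , _) =
    contradiction 1+n<n (<⇒≯ (n<1+n n))
  interleaved-arcs (inj₂ (inj₂ (inj₂ (inj₂ (refl , refl))))) (inj₂ (inj₂ (inj₂ (inj₂ (refl , _))))) (1+n<1+n , _) =
    contradiction 1+n<1+n (<-irrefl refl)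

  data Either (R : ℕ → ℕ → Set) (a b : ℕ) : Set where
    forward  : R a b → Either R a b
    backward : R b a → Either R a b

  FirstDiagonal SecondDiagonal : ℕ → ℕ → Set
  FirstDiagonal a b = a ≡ n × b ≡ 2 + n
  SecondDiagonal a b = a ≡ 1 + n × b ≡ 3 + n

  CrossingPair : ℕ → ℕ → ℕ → ℕ → Set
  CrossingPair a b c d = (Either FirstDiagonal a b × Either SecondDiagonal c d)
                       ⊎ (Either SecondDiagonal a b × Either FirstDiagonal c d)

  Either-swap : ∀ {R a b} → Either R a b → Either R b a
  Either-swap (forward p) = backward p
  Either-swap (backward p) = forward p

  CrossingPair-swapˡ : ∀ {a b c d} → CrossingPair a b c d → CrossingPair b a c d
  CrossingPair-swapˡ (inj₁ (ab , cd)) = inj₁ (Either-swap ab , cd)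
  CrossingPair-swapˡ (inj₂ (ab , cd)) = inj₂ (Either-swap ab , cd)

  CrossingPair-swapʳ : ∀ {a b c d} → CrossingPair a b c d → CrossingPair a b d c
  CrossingPair-swapʳ (inj₁ (ab , cd)) = inj₁ (ab , Either-swap cd)
  CrossingPair-swapʳ (inj₂ (ab , cd)) = inj₂ (ab , Either-swap cd)

  crossing-arcs : ∀ {a b c d} → Arc a b → Arc c d → Crossing a b c d → CrossingPair a b c d
  crossing-arcs ab cd cr with Crossing⇒Interleaved (proj₁ (Arc⇒< ab)) (proj₁ (Arc⇒< cd)) cr
  ... | inj₁ abcd = let (first , second) = interleaved-arcs ab cd abcd in inj₁ (forward first , forward second)
  ... | inj₂ cdab = let (first , second) = interleaved-arcs cd ab cdab in inj₂ (forward second , forward first)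

  crossing-edges : ∀ {a b c d} → Edge a b → Edge c d → Crossing a b c d → CrossingPair a b c d
  crossing-edges (inj₁ ab) (inj₁ cd) cr = crossing-arcs ab cd cr
  crossing-edges (inj₁ ab) (inj₂ dc) cr = CrossingPair-swapʳ (crossing-arcs ab dc (Crossing-swapʳ cr))
  crossing-edges (inj₂ ba) (inj₁ cd) cr = CrossingPair-swapˡ (crossing-arcs ba cd (Crossing-swapˡ cr))
  crossing-edges (inj₂ ba) (inj₂ dc) cr =
    CrossingPair-swapˡ (CrossingPair-swapʳ (crossing-arcs ba dc (Crossing-swapʳ (Crossing-swapˡ cr))))

  SameEdgeℕ : ℕ → ℕ → ℕ → ℕ → Set
  SameEdgeℕ c d e f = (c ≡ e × d ≡ f) ⊎ (c ≡ f × d ≡ e)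

  Either-same : ∀ {R} → (∀ {a b a′ b′} → R a b → R a′ b′ → a ≡ a′ × b ≡ b′) →
    ∀ {c d e f} → Either R c d → Either R e f → SameEdgeℕ c d e f
  Either-same R-unique (forward cd) (forward ef) = inj₁ (R-unique cd ef)
  Either-same R-unique (forward cd) (backward fe) = inj₂ (R-unique cd fe)
  Either-same R-unique (backward dc) (forward ef) = let (d≡e , c≡f) = R-unique dc ef in inj₂ (c≡f , d≡e)
  Either-same R-unique (backward dc) (backward fe) = let (d≡f , c≡e) = R-unique dc fe in inj₁ (c≡e , d≡f)

  first≢second : ∀ {a b} → Either FirstDiagonal a b → ¬ Either SecondDiagonal a b
  first≢second (forward (refl , _)) (forward (e , _)) = m≢1+n+m n {0} e
  first≢second (forward (refl , _)) (backward (_ , e)) = m≢1+n+m n {2} e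
  first≢second (backward (refl , _)) (forward (_ , e)) = m≢1+n+m n {2} e
  first≢second (backward (refl , _)) (backward (e , _)) = m≢1+n+m n {0} e

  FirstDiagonal-unique : ∀ {a b a′ b′} → FirstDiagonal a b → FirstDiagonal a′ b′ → a ≡ a′ × b ≡ b′
  FirstDiagonal-unique (refl , refl) (refl , refl) = refl , refl

  SecondDiagonal-unique : ∀ {a b a′ b′} → SecondDiagonal a b → SecondDiagonal a′ b′ → a ≡ a′ × b ≡ b′
  SecondDiagonal-unique (refl , refl) (refl , refl) = refl , refl

  CrossingPair-unique : ∀ {a b c d e f} → CrossingPair a b c d → CrossingPair a b e f → SameEdgeℕ c d e f
  CrossingPair-unique (inj₁ (_ , cd)) (inj₁ (_ , ef)) = Either-same SecondDiagonal-unique cd ef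
  CrossingPair-unique (inj₁ (ab , _)) (inj₂ (ab′ , _)) = contradiction ab′ (first≢second ab)
  CrossingPair-unique (inj₂ (ab , _)) (inj₁ (ab′ , _)) = contradiction ab (first≢second ab′)
  CrossingPair-unique (inj₂ (_ , cd)) (inj₂ (_ , ef)) = Either-same FirstDiagonal-unique cd ef


  Cross⇒Crossing : ∀ {a b c d} → Cross G toℕ a b c d → Crossing (toℕ a) (toℕ b) (toℕ c) (toℕ d)
  Cross⇒Crossing ((c≢a , c≢b , d≢a , d≢b) , between) =
    (c≢a ∘ toℕ-injective , c≢b ∘ toℕ-injective , d≢a ∘ toℕ-injective , d≢b ∘ toℕ-injective) , between

  SameEdgeℕ⇒SameEdge : ∀ {c d e f} → SameEdgeℕ (toℕ c) (toℕ d) (toℕ e) (toℕ f) → SameEdge G c d e f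
  SameEdgeℕ⇒SameEdge (inj₁ (c≡e , d≡f)) = inj₁ (toℕ-injective c≡e , toℕ-injective d≡f)
  SameEdgeℕ⇒SameEdge (inj₂ (c≡f , d≡e)) = inj₂ (toℕ-injective c≡f , toℕ-injective d≡e)

  crossed-once : ∀ a b c d e f → Adj G a b → Adj G c d → Adj G e f →
    Cross G toℕ a b c d → Cross G toℕ a b e f → SameEdge G c d e f
  crossed-once a b c d e f ab cd ef abcd abef = SameEdgeℕ⇒SameEdge (CrossingPair-unique
    (crossing-edges (Adj⇒Edge {a} {b} ab) (Adj⇒Edge {c} {d} cd) (Cross⇒Crossing abcd))
    (crossing-edges (Adj⇒Edge {a} {b} ab) (Adj⇒Edge {e} {f} ef) (Cross⇒Crossing abef)))

  pseudoOuterplanar : PseudoOuterplanar G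
  pseudoOuterplanar _ _ = toℕ , toℕ-injective , λ a b c d e f _ _ _ _ _ _ → crossed-once a b c d e f

theorem5p4 : (n : ℕ) → 1 ≤ n →
    Σ (Graph (2 * n + 5)) λ G →
      TwoConnected G × PseudoOuterplanar G × MaxDegree G 3
        × EdgeChromaticNumber G 4
theorem5p4 n _ = subst
  (λ N → Σ (Graph N) λ G → TwoConnected G × PseudoOuterplanar G × MaxDegree G 3 × EdgeChromaticNumber G 4)
  (sym (2*m+5≡5+[m+m] n))
  (G , twoConnected , pseudoOuterplanar , maxDegree , edgeChromaticNumber)
  where open Construction n
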